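{- For $i=1,2$ let $G_i$ be a graph with $k_i$ peripheral vertices. Then \[ PWW(G_1\times G_2)=k_2^2\,PWW(G_1)+k_1^2\,PWW(G_2)+2\,PW(G_1)\,PW(G_2). \]
   Context: All graphs are finite, simple, undirected, connected and have at least two vertices. The cartesian product $G_1\times G_2$ has vertex set $V(G_1)\times V(G_2)$, with $(a,x)$ adjacent to $(b,y)$ iff either $a=b$ and $xy\in E(G_2)$, or $ab\in E(G_1)$ and $x=y$. $d(u,v)$ is shortest-path distance; the eccentricity of $v$ is $\max_u d(u,v)$; the diameter is the maximum eccentricity; a vertex is peripheral if its eccentricity equals the diameter; $\operatorname{Peri}(G)$ is the set of peripheral vertices. With sums over unordered pairs of distinct peripheral vertices: $PW(G)=\sum_{\{u,v\}\subseteq\operatorname{Peri}(G)}d(u,v)$ and $PWW(G)=\frac12\sum_{\{u,v\}\subseteq\operatorname{Peri}(G)}(d(u,v)+d(u,v)^2)$. -}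

module Defs where

open import Data.Nat using (ℕ; zero; suc; _+_; _*_; _⊔_; _≤_; _≡ᵇ_)
open import Data.Nat.DivMod using (_/_)
open import Data.Bool using (Bool; true; false; if_then_else_; _∧_; _∨_)
open import Data.List using (List; []; _∷_; map; _++_; length; foldr; filterᵇ; cartesianProduct)
open import Data.Nat.ListAction using (sum)
open import Data.Bool.ListAction using (any)
open import Data.List.Membership.Propositional using (_∈_)
open import Data.List.Relation.Unary.Unique.Propositional using (Unique)
open import Data.Product using (Σ; _×_; _,_; proj₁; proj₂; ∃)
open import Data.Product.Properties using (≡-dec)
open import Relation.Binary.Definitions using (DecidableEquality)
open import Relation.Binary.PropositionalEquality using (_≡_)
open import Relation.Nullary.Decidable using (⌊_⌋)

record Graph : Set₁ where
  field
    V     : Set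
    _≟_   : DecidableEquality V
    verts : List V
    adj   : V → V → Bool
open Graph public

data Walk (G : Graph) : ℕ → V G → V G → Set where
  here : ∀ {u} → Walk G zero u u
  step : ∀ {k u w v} → adj G u w ≡ true → Walk G k w v → Walk G (suc k) u v

record IsGraph (G : Graph) : Set where
  field
    complete  : ∀ v → v ∈ verts G
    unique    : Unique (verts G)
    symmetric : ∀ u v → adj G u v ≡ adj G v u
    irreflex  : ∀ v → adj G v v ≡ false
    connected : ∀ u v → ∃ λ k → Walk G k u v
    twoVerts  : 2 ≤ length (verts G)

_□_ : Graph → Graph → Graph
G₁ □ G₂ = record
  { V     = V G₁ × V G₂
  ; _≟_   = ≡-dec (_≟_ G₁) (_≟_ G₂)
  ; verts = cartesianProduct (verts G₁) (verts G₂)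
  ; adj   = λ { (a , x) (b , y) →
               (⌊ _≟_ G₁ a b ⌋ ∧ adj G₂ x y) ∨ (adj G₁ a b ∧ ⌊ _≟_ G₂ x y ⌋) }
  }

reach : (G : Graph) → ℕ → V G → V G → Bool
reach G zero    u v = ⌊ _≟_ G u v ⌋
reach G (suc k) u v = any (λ w → adj G u w ∧ reach G k w v) (verts G)

-- least k < n with f k = true, and n if there is none
firstTrue : (ℕ → Bool) → ℕ → ℕ
firstTrue f zero    = zero
firstTrue f (suc n) = if f zero then zero else suc (firstTrue (λ k → f (suc k)) n)

-- shortest-path distance: least length of a walk from u to v
-- (in a connected graph this is < number of vertices)
dist : (G : Graph) → V G → V G → ℕ
dist G u v = firstTrue (λ k → reach G k u v) (length (verts G))

maxList : List ℕ → ℕ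
maxList = foldr _⊔_ 0

ecc : (G : Graph) → V G → ℕ
ecc G v = maxList (map (λ u → dist G u v) (verts G))

diam : Graph → ℕ
diam G = maxList (map (ecc G) (verts G))

Peri : (G : Graph) → List (V G)
Peri G = filterᵇ (λ v → ecc G v ≡ᵇ diam G) (verts G)

-- unordered pairs of distinct entries of a duplicate-free list
pairs : {A : Set} → List A → List (A × A)
pairs []       = []
pairs (x ∷ xs) = map (λ y → (x , y)) xs ++ pairs xs

PW : Graph → ℕ
PW G = sum (map (λ p → dist G (proj₁ p) (proj₂ p)) (pairs (Peri G)))

-- each term d + d² is even, so halving termwise equals halving the sum
PWW : Graph → ℕ
PWW G = sum (map (λ p → let d = dist G (proj₁ p) (proj₂ p) in (d + d * d) / 2)
                 (pairs (Peri G)))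

-- Distances add in a cartesian product, d((a,x),(b,y)) = d₁(a,b) + d₂(x,y): a walk in G₁ □ G₂
-- splits into walks in the factors whose lengths add up, and walks in the factors combine into
-- one in the product. Hence eccentricities and diameters add as well, and the peripheral vertices
-- of G₁ □ G₂ are exactly the pairs of peripheral vertices. The summand of PWW is the triangular
-- number T(d) = d(d+1)/2, and T(d₁ + d₂) = T(d₁) + T(d₂) + d₁d₂. Summed over ordered pairs of
-- peripheral vertices (twice the sum over unordered pairs, since the summands are symmetric and
-- vanish on the diagonal) the three terms give k₂² times the sum for G₁, k₁² times the sum for G₂,
-- and the product of the two distance sums.

module Submission where

open import Defs
open import Algebra.Structures using (IsMonoid)
open import Data.Bool using (Bool; true; false; T; _∧_)
open import Data.Bool.Properties using (T-≡; T-∧; T-∨; ⇔→≡)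
open import Data.Empty using (⊥-elim)
open import Data.List using (List; []; _∷_; map; _++_; length; foldr; filterᵇ; cartesianProduct)
open import Data.List.Properties using (length-removeAt′; map-++; map-∘; map-cong; filter-++; filter-≐)
open import Data.List.Relation.Unary.Any using (here; there; index; _─_; satisfied)
open import Data.List.Relation.Unary.Any.Properties using (any⁺; any⁻)
import Data.List.Relation.Unary.All as All
open import Data.List.Relation.Unary.All.Properties using (¬Any⇒All¬)
open import Data.List.Relation.Unary.AllPairs using ([]; _∷_)
open import Data.List.Relation.Unary.Unique.Propositional using (Unique)
open import Data.List.Membership.Propositional using (_∈_; lose)
open import Data.List.Membership.Propositional.Properties using (∈-cartesianProduct⁺)
import Data.List.Membership.DecPropositional as DecMembership
open import Data.List.Relation.Binary.Subset.Propositional using (_⊆_)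
open import Data.Nat using (ℕ; zero; suc; _+_; _*_; _⊔_; _≤_; _<_; _≡ᵇ_; z≤n; s≤s)
open import Data.Nat.DivMod using (_/_; m*[n/m]≡n)
open import Data.Nat.Divisibility using (_∣_; _∣0; ∣m∣n⇒∣m+n; m∣m*n)
open import Data.Nat.ListAction using (sum)
open import Data.Nat.ListAction.Properties using (sum-++)
open import Data.Nat.Properties
  using ( ≤-antisym; ≤-trans; ≮⇒≥; <⇒≤; +-suc; +-comm; +-mono-≤; +-monoʳ-≤; +-cancelʳ-≤; +-cancelˡ-≡
        ; *-comm; *-zeroʳ; *-identityˡ; *-identityʳ; *-distribˡ-+; *-distribʳ-+; *-cancelˡ-≡
        ; ⊔-identityʳ; +-distribˡ-⊔; m≤m⊔n; m≤n⊔m; ≡ᵇ⇒≡; ≡⇒≡ᵇ; +-0-isMonoid; ⊔-0-isMonoid )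
open import Data.Nat.Tactic.RingSolver using (solve-∀)
open import Data.Product using (∃; ∃₂; _×_; _,_; proj₁; proj₂)
open import Data.Sum using (_⊎_; inj₁; inj₂)
open import Function using (_∘_; Equivalence; mk⇔)
open import Relation.Binary.PropositionalEquality
  using (_≡_; _≢_; refl; sym; trans; subst; cong; cong₂; ≢-sym; module ≡-Reasoning)
open import Relation.Nullary using (¬_; yes; no; contradiction)
open import Relation.Nullary.Decidable using (T?; toWitness; fromWitness)

open Equivalence using (to; from)

private
  variable
    A B C : Set
    k m n : ℕ

∈-─ : ∀ {x y : A} {ys} (x∈ys : x ∈ ys) → y ∈ ys → y ≢ x → y ∈ (ys ─ x∈ys)
∈-─ (here refl) (here refl)  y≢x = contradiction refl y≢x
∈-─ (here refl) (there y∈ys) _   = y∈ys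
∈-─ (there _)   (here y≡z)   _   = here y≡z
∈-─ (there x∈ys) (there y∈ys) y≢x = there (∈-─ x∈ys y∈ys y≢x)

unique-⊆⇒length≤ : {xs ys : List A} → Unique xs → xs ⊆ ys → length xs ≤ length ys
unique-⊆⇒length≤ [] _ = z≤n
unique-⊆⇒length≤ {ys = ys} (x≢xs ∷ xs-unique) x∷xs⊆ys =
  subst (_ ≤_) (sym (length-removeAt′ ys (index x∈ys)))
    (s≤s (unique-⊆⇒length≤ xs-unique λ y∈xs →
      ∈-─ x∈ys (x∷xs⊆ys (there y∈xs)) (≢-sym (All.lookup x≢xs y∈xs))))
  where x∈ys = x∷xs⊆ys (here refl)

module _ {_∙_ : C → C → C} {ε : C} (monoid : IsMonoid _≡_ _∙_ ε) where
  open IsMonoid monoid using (assoc; identityˡ)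

  foldr-++-homo : ∀ xs ys → foldr _∙_ ε (xs ++ ys) ≡ foldr _∙_ ε xs ∙ foldr _∙_ ε ys
  foldr-++-homo []       ys = sym (identityˡ _)
  foldr-++-homo (x ∷ xs) ys = trans (cong (x ∙_) (foldr-++-homo xs ys)) (sym (assoc x _ _))

  foldr-map-cartesianProduct : ∀ (h : A × B → C) xs ys →
    foldr _∙_ ε (map h (cartesianProduct xs ys)) ≡
    foldr _∙_ ε (map (λ a → foldr _∙_ ε (map (λ b → h (a , b)) ys)) xs)
  foldr-map-cartesianProduct h []       ys = refl
  foldr-map-cartesianProduct h (x ∷ xs) ys = begin
    fold (map h (map (x ,_) ys ++ cartesianProduct xs ys))
      ≡⟨ cong fold (map-++ h (map (x ,_) ys) _) ⟩
    fold (map h (map (x ,_) ys) ++ map h (cartesianProduct xs ys))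
      ≡⟨ foldr-++-homo (map h (map (x ,_) ys)) _ ⟩
    fold (map h (map (x ,_) ys)) ∙ fold (map h (cartesianProduct xs ys))
      ≡⟨ cong₂ _∙_ (cong fold (sym (map-∘ ys))) (foldr-map-cartesianProduct h xs ys) ⟩
    fold (map (λ b → h (x , b)) ys) ∙ fold (map (λ a → fold (map (λ b → h (a , b)) ys)) xs) ∎
    where
      open ≡-Reasoning
      fold = foldr _∙_ ε

filterᵇ-map : ∀ (p : B → Bool) (f : A → B) xs → filterᵇ p (map f xs) ≡ map f (filterᵇ (p ∘ f) xs)
filterᵇ-map p f []       = refl
filterᵇ-map p f (x ∷ xs) with p (f x)
... | true  = cong (f x ∷_) (filterᵇ-map p f xs)
... | false = filterᵇ-map p f xs

filterᵇ-false : (xs : List A) → filterᵇ (λ _ → false) xs ≡ []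
filterᵇ-false []       = refl
filterᵇ-false (x ∷ xs) = filterᵇ-false xs

filterᵇ-cartesianProduct : ∀ (p : A → Bool) (q : B → Bool) xs ys →
  filterᵇ (λ v → p (proj₁ v) ∧ q (proj₂ v)) (cartesianProduct xs ys) ≡
  cartesianProduct (filterᵇ p xs) (filterᵇ q ys)
filterᵇ-cartesianProduct p q []       ys = refl
filterᵇ-cartesianProduct p q (x ∷ xs) ys = begin
  filterᵇ r (map (x ,_) ys ++ cartesianProduct xs ys)
    ≡⟨ filter-++ (T? ∘ r) (map (x ,_) ys) _ ⟩
  filterᵇ r (map (x ,_) ys) ++ filterᵇ r (cartesianProduct xs ys)
    ≡⟨ cong₂ _++_ (filterᵇ-map r (x ,_) ys) (filterᵇ-cartesianProduct p q xs ys) ⟩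
  map (x ,_) (filterᵇ (λ y → p x ∧ q y) ys) ++ rest
    ≡⟨ row ⟩
  cartesianProduct (filterᵇ p (x ∷ xs)) (filterᵇ q ys) ∎
  where
    open ≡-Reasoning
    r = λ v → p (proj₁ v) ∧ q (proj₂ v)
    rest = cartesianProduct (filterᵇ p xs) (filterᵇ q ys)
    row : map (x ,_) (filterᵇ (λ y → p x ∧ q y) ys) ++ rest
        ≡ cartesianProduct (filterᵇ p (x ∷ xs)) (filterᵇ q ys)
    row with p x
    ... | true  = refl
    ... | false = cong (λ zs → map (x ,_) zs ++ rest) (filterᵇ-false ys)

filterᵇ-cong : ∀ {p q : A → Bool} → (∀ x → p x ≡ q x) → ∀ xs → filterᵇ p xs ≡ filterᵇ q xs
filterᵇ-cong {p = p} {q} p≗q =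
  filter-≐ (T? ∘ p) (T? ∘ q) ((λ {x} → subst T (p≗q x)) , (λ {x} → subst T (sym (p≗q x))))

maxList-map-+ˡ : ∀ c (f : A → ℕ) xs → 0 < length xs →
                 maxList (map (λ x → c + f x) xs) ≡ c + maxList (map f xs)
maxList-map-+ˡ c f (x ∷ [])         _ = trans (⊔-identityʳ _) (cong (c +_) (sym (⊔-identityʳ _)))
maxList-map-+ˡ c f (x ∷ xs@(_ ∷ _)) _ =
  trans (cong (c + f x ⊔_) (maxList-map-+ˡ c f xs (s≤s z≤n))) (sym (+-distribˡ-⊔ c (f x) _))

maxList-map-cartesianProduct-+ : ∀ (h : A × B → ℕ) f g xs ys →
  (∀ a b → h (a , b) ≡ f a + g b) → 0 < length xs → 0 < length ys →
  maxList (map h (cartesianProduct xs ys)) ≡ maxList (map f xs) + maxList (map g ys)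
maxList-map-cartesianProduct-+ h f g xs ys h≡f+g xs-nonempty ys-nonempty = begin
  maxList (map h (cartesianProduct xs ys))
    ≡⟨ foldr-map-cartesianProduct ⊔-0-isMonoid h xs ys ⟩
  maxList (map (λ a → maxList (map (λ b → h (a , b)) ys)) xs)
    ≡⟨ cong maxList (map-cong (λ a → trans (cong maxList (map-cong (h≡f+g a) ys))
                                          (maxList-map-+ˡ (f a) g ys ys-nonempty)) xs) ⟩
  maxList (map (λ a → f a + maxList (map g ys)) xs)
    ≡⟨ cong maxList (map-cong (λ a → +-comm (f a) _) xs) ⟩
  maxList (map (λ a → maxList (map g ys) + f a) xs)
    ≡⟨ maxList-map-+ˡ _ f xs xs-nonempty ⟩
  maxList (map g ys) + maxList (map f xs)
    ≡⟨ +-comm _ (maxList (map f xs)) ⟩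
  maxList (map f xs) + maxList (map g ys) ∎
  where open ≡-Reasoning

f≤maxList : ∀ (f : A → ℕ) {x xs} → x ∈ xs → f x ≤ maxList (map f xs)
f≤maxList f {xs = y ∷ _} (here refl) = m≤m⊔n (f y) _
f≤maxList f {xs = y ∷ _} (there x∈xs) = ≤-trans (f≤maxList f x∈xs) (m≤n⊔m (f y) _)

firstTrue-least : ∀ (f : ℕ → Bool) n {j} → j < firstTrue f n → ¬ T (f j)
firstTrue-least f (suc n) {j} j< with f 0 in f0≡
firstTrue-least f (suc n) {zero}  _        | false = subst T f0≡
firstTrue-least f (suc n) {suc j} (s≤s j<) | false = firstTrue-least (f ∘ suc) n j<

firstTrue-true : ∀ (f : ℕ → Bool) n {K} → T (f K) → K < n → T (f (firstTrue f n))
firstTrue-true f (suc n) {K} fK K<n with f 0 in f0≡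
... | true = subst T (sym f0≡) _
firstTrue-true f (suc n) {zero}  fK _          | false = ⊥-elim (subst T f0≡ fK)
firstTrue-true f (suc n) {suc K} fK (s≤s K<n) | false = firstTrue-true (f ∘ suc) n fK K<n

m+n≡o+p⇒m≡o×n≡p : ∀ {m n o p} → m ≤ o → n ≤ p → m + n ≡ o + p → m ≡ o × n ≡ p
m+n≡o+p⇒m≡o×n≡p {m} {n} {o} {p} m≤o n≤p eq = m≡o , +-cancelˡ-≡ m n p (trans eq (cong (_+ p) (sym m≡o)))
  where
    m≡o : m ≡ o
    m≡o = ≤-antisym m≤o (+-cancelʳ-≤ n o m (subst (o + n ≤_) (sym eq) (+-monoʳ-≤ o n≤p)))

≡ᵇ-+ : ∀ {m n o p} → m ≤ o → n ≤ p → (m + n ≡ᵇ o + p) ≡ ((m ≡ᵇ o) ∧ (n ≡ᵇ p))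
≡ᵇ-+ {m} {n} {o} {p} m≤o n≤p = ⇔→≡ (mk⇔ (to T-≡ ∘ split ∘ from T-≡) (to T-≡ ∘ join ∘ from T-≡))
  where
    split : T (m + n ≡ᵇ o + p) → T ((m ≡ᵇ o) ∧ (n ≡ᵇ p))
    split t with m≡o , n≡p ← m+n≡o+p⇒m≡o×n≡p m≤o n≤p (≡ᵇ⇒≡ _ _ t) =
      from T-∧ (≡⇒≡ᵇ m o m≡o , ≡⇒≡ᵇ n p n≡p)
    join : T ((m ≡ᵇ o) ∧ (n ≡ᵇ p)) → T (m + n ≡ᵇ o + p)
    join t with m≡o , n≡p ← to T-∧ t =
      ≡⇒≡ᵇ (m + n) (o + p) (cong₂ _+_ (≡ᵇ⇒≡ m o m≡o) (≡ᵇ⇒≡ n p n≡p))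

triangle : ℕ → ℕ
triangle n = (n + n * n) / 2

2∣n+n*n : ∀ n → 2 ∣ n + n * n
2∣n+n*n zero    = 2 ∣0
2∣n+n*n (suc n) = subst (2 ∣_) (next n) (∣m∣n⇒∣m+n (2∣n+n*n n) (m∣m*n (suc n)))
  where
    next : ∀ n → n + n * n + 2 * suc n ≡ suc n + suc n * suc n
    next = solve-∀

2*triangle : ∀ n → 2 * triangle n ≡ n + n * n
2*triangle n = m*[n/m]≡n (2∣n+n*n n)

triangle-+ : ∀ m n → triangle (m + n) ≡ triangle m + triangle n + m * n
triangle-+ m n = *-cancelˡ-≡ _ _ 2 (begin
  2 * triangle (m + n)
    ≡⟨ 2*triangle (m + n) ⟩
  (m + n) + (m + n) * (m + n)
    ≡⟨ expand m n ⟩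
  (m + m * m) + (n + n * n) + 2 * (m * n)
    ≡⟨ cong₂ (λ a b → a + b + 2 * (m * n)) (sym (2*triangle m)) (sym (2*triangle n)) ⟩
  2 * triangle m + 2 * triangle n + 2 * (m * n)
    ≡⟨ factor (triangle m) (triangle n) (m * n) ⟩
  2 * (triangle m + triangle n + m * n) ∎)
  where
    open ≡-Reasoning
    expand : ∀ m n → (m + n) + (m + n) * (m + n) ≡ (m + m * m) + (n + n * n) + 2 * (m * n)
    expand = solve-∀
    factor : ∀ a b c → 2 * a + 2 * b + 2 * c ≡ 2 * (a + b + c)
    factor = solve-∀

-- Sums over ordered and unordered pairs

sum-map-cong : ∀ {f g : A → ℕ} → (∀ x → f x ≡ g x) → ∀ xs → sum (map f xs) ≡ sum (map g xs)
sum-map-cong f≗g xs = cong sum (map-cong f≗g xs)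

sum-map-+ : ∀ (f g : A → ℕ) xs → sum (map (λ x → f x + g x) xs) ≡ sum (map f xs) + sum (map g xs)
sum-map-+ f g []       = refl
sum-map-+ f g (x ∷ xs) = trans (cong (f x + g x +_) (sum-map-+ f g xs)) (interchange (f x) (g x) _ _)
  where
    interchange : ∀ a b c d → a + b + (c + d) ≡ a + c + (b + d)
    interchange = solve-∀

sum-map-*ˡ : ∀ c (f : A → ℕ) xs → sum (map (λ x → c * f x) xs) ≡ c * sum (map f xs)
sum-map-*ˡ c f []       = sym (*-zeroʳ c)
sum-map-*ˡ c f (x ∷ xs) = trans (cong (c * f x +_) (sum-map-*ˡ c f xs)) (sym (*-distribˡ-+ c (f x) _))

sum-map-*ʳ : ∀ c (f : A → ℕ) xs → sum (map (λ x → f x * c) xs) ≡ sum (map f xs) * c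
sum-map-*ʳ c f []       = refl
sum-map-*ʳ c f (x ∷ xs) = trans (cong (f x * c +_) (sum-map-*ʳ c f xs)) (sym (*-distribʳ-+ c (f x) _))

sum-map-const : ∀ c (xs : List A) → sum (map (λ _ → c) xs) ≡ length xs * c
sum-map-const c []       = refl
sum-map-const c (x ∷ xs) = cong (c +_) (sum-map-const c xs)

sum-map-cartesianProduct : ∀ (h : A × B → ℕ) xs ys →
  sum (map h (cartesianProduct xs ys)) ≡ sum (map (λ a → sum (map (λ b → h (a , b)) ys)) xs)
sum-map-cartesianProduct = foldr-map-cartesianProduct +-0-isMonoid

pairSum : List A → (A → A → ℕ) → ℕ
pairSum xs f = sum (map (λ p → f (proj₁ p) (proj₂ p)) (pairs xs))

doubleSum : List A → (A → A → ℕ) → ℕ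
doubleSum xs f = sum (map (λ x → sum (map (f x) xs)) xs)

pairSum-∷ : ∀ (f : A → A → ℕ) x xs → pairSum (x ∷ xs) f ≡ sum (map (f x) xs) + pairSum xs f
pairSum-∷ f x xs = begin
  sum (map g (map (x ,_) xs ++ pairs xs))      ≡⟨ cong sum (map-++ g (map (x ,_) xs) (pairs xs)) ⟩
  sum (map g (map (x ,_) xs) ++ map g (pairs xs)) ≡⟨ sum-++ (map g (map (x ,_) xs)) _ ⟩
  sum (map g (map (x ,_) xs)) + pairSum xs f     ≡⟨ cong (λ ys → sum ys + pairSum xs f) (sym (map-∘ xs)) ⟩
  sum (map (f x) xs) + pairSum xs f              ∎
  where
    open ≡-Reasoning
    g = λ (p : _ × _) → f (proj₁ p) (proj₂ p)

record SymmetricHollow {A : Set} (f : A → A → ℕ) : Set where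
  field
    symmetric : ∀ x y → f x y ≡ f y x
    hollow    : ∀ x → f x x ≡ 0
open SymmetricHollow

doubleSum≡2*pairSum : ∀ {f : A → A → ℕ} → SymmetricHollow f → ∀ xs → doubleSum xs f ≡ 2 * pairSum xs f
doubleSum≡2*pairSum     f-sh []       = refl
doubleSum≡2*pairSum {f = f} f-sh (x ∷ xs) = begin
  (f x x + row) + sum (map (λ y → f y x + sum (map (f y) xs)) xs)
    ≡⟨ cong₂ (λ a b → a + row + b) (hollow f-sh x) (sum-map-+ (λ y → f y x) (λ y → sum (map (f y) xs)) xs) ⟩
  row + (sum (map (λ y → f y x) xs) + doubleSum xs f)
    ≡⟨ cong₂ (λ a b → row + (a + b))
             (sum-map-cong (λ y → symmetric f-sh y x) xs) (doubleSum≡2*pairSum f-sh xs) ⟩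
  row + (row + 2 * pairSum xs f)
    ≡⟨ double row (pairSum xs f) ⟩
  2 * (row + pairSum xs f)
    ≡⟨ cong (2 *_) (sym (pairSum-∷ f x xs)) ⟩
  2 * pairSum (x ∷ xs) f ∎
  where
    open ≡-Reasoning
    row = sum (map (f x) xs)
    double : ∀ r s → r + (r + 2 * s) ≡ 2 * (r + s)
    double = solve-∀

∘-symmetricHollow : ∀ (g : ℕ → ℕ) {f : A → A → ℕ} → g 0 ≡ 0 → SymmetricHollow f →
                    SymmetricHollow (λ x y → g (f x y))
∘-symmetricHollow g g0≡0 f-sh = record
  { symmetric = λ x y → cong g (symmetric f-sh x y)
  ; hollow    = λ x → trans (cong g (hollow f-sh x)) g0≡0
  }

×-symmetricHollow : ∀ {f : A → A → ℕ} {g : B → B → ℕ} → SymmetricHollow f → SymmetricHollow g →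
                    SymmetricHollow (λ u v → f (proj₁ u) (proj₁ v) + g (proj₂ u) (proj₂ v))
×-symmetricHollow f-sh g-sh = record
  { symmetric = λ u v → cong₂ _+_ (symmetric f-sh _ _) (symmetric g-sh _ _)
  ; hollow    = λ u → cong₂ _+_ (hollow f-sh _) (hollow g-sh _)
  }

doubleSum-cong : ∀ {f g : A → A → ℕ} → (∀ x y → f x y ≡ g x y) → ∀ xs → doubleSum xs f ≡ doubleSum xs g
doubleSum-cong f≗g xs = sum-map-cong (λ x → sum-map-cong (f≗g x) xs) xs

doubleSum-+ : ∀ (f g : A → A → ℕ) xs →
              doubleSum xs (λ x y → f x y + g x y) ≡ doubleSum xs f + doubleSum xs g
doubleSum-+ f g xs =
  trans (sum-map-cong (λ x → sum-map-+ (f x) (g x) xs) xs) (sum-map-+ _ _ xs)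

doubleSum-cartesianProduct-* : ∀ (f : A → A → ℕ) (g : B → B → ℕ) xs ys →
  doubleSum (cartesianProduct xs ys) (λ u v → f (proj₁ u) (proj₁ v) * g (proj₂ u) (proj₂ v))
  ≡ doubleSum xs f * doubleSum ys g
doubleSum-cartesianProduct-* f g xs ys = begin
  doubleSum (cartesianProduct xs ys) (λ u v → f (proj₁ u) (proj₁ v) * g (proj₂ u) (proj₂ v))
    ≡⟨ sum-map-cartesianProduct _ xs ys ⟩
  Σ xs (λ a → Σ ys (λ x → Σ (cartesianProduct xs ys) (λ v → f a (proj₁ v) * g x (proj₂ v))))
    ≡⟨ sum-map-cong (λ a → sum-map-cong (λ x → sum-map-cartesianProduct _ xs ys) ys) xs ⟩
  Σ xs (λ a → Σ ys (λ x → Σ xs (λ b → Σ ys (λ y → f a b * g x y))))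
    ≡⟨ sum-map-cong (λ a → sum-map-cong (λ x → sum-map-cong (λ b → sum-map-*ˡ (f a b) (g x) ys) xs) ys) xs ⟩
  Σ xs (λ a → Σ ys (λ x → Σ xs (λ b → f a b * Σ ys (g x))))
    ≡⟨ sum-map-cong (λ a → sum-map-cong (λ x → sum-map-*ʳ (Σ ys (g x)) (f a) xs) ys) xs ⟩
  Σ xs (λ a → Σ ys (λ x → Σ xs (f a) * Σ ys (g x)))
    ≡⟨ sum-map-cong (λ a → sum-map-*ˡ (Σ xs (f a)) (λ x → Σ ys (g x)) ys) xs ⟩
  Σ xs (λ a → Σ xs (f a) * doubleSum ys g)
    ≡⟨ sum-map-*ʳ (doubleSum ys g) (λ a → Σ xs (f a)) xs ⟩
  doubleSum xs f * doubleSum ys g ∎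
  where
    open ≡-Reasoning
    Σ : ∀ {C : Set} → List C → (C → ℕ) → ℕ
    Σ zs h = sum (map h zs)

doubleSum-const : ∀ c (xs : List A) → doubleSum xs (λ _ _ → c) ≡ length xs * (length xs * c)
doubleSum-const c xs = trans (sum-map-cong (λ _ → sum-map-const c xs) xs) (sum-map-const _ xs)

doubleSum-cartesianProduct-proj₁ : ∀ (f : A → A → ℕ) (xs : List A) (ys : List B) →
  doubleSum (cartesianProduct xs ys) (λ u v → f (proj₁ u) (proj₁ v))
  ≡ length ys * length ys * doubleSum xs f
doubleSum-cartesianProduct-proj₁ f xs ys = begin
  doubleSum (cartesianProduct xs ys) (λ u v → f (proj₁ u) (proj₁ v))
    ≡⟨ doubleSum-cong (λ u v → sym (*-identityʳ _)) (cartesianProduct xs ys) ⟩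
  doubleSum (cartesianProduct xs ys) (λ u v → f (proj₁ u) (proj₁ v) * 1)
    ≡⟨ doubleSum-cartesianProduct-* f (λ _ _ → 1) xs ys ⟩
  doubleSum xs f * doubleSum ys (λ _ _ → 1)
    ≡⟨ cong (doubleSum xs f *_) (trans (doubleSum-const 1 ys) (cong (length ys *_) (*-identityʳ _))) ⟩
  doubleSum xs f * (length ys * length ys)
    ≡⟨ *-comm (doubleSum xs f) _ ⟩
  length ys * length ys * doubleSum xs f ∎
  where open ≡-Reasoning

doubleSum-cartesianProduct-proj₂ : ∀ (g : B → B → ℕ) (xs : List A) (ys : List B) →
  doubleSum (cartesianProduct xs ys) (λ u v → g (proj₂ u) (proj₂ v))
  ≡ length xs * length xs * doubleSum ys g
doubleSum-cartesianProduct-proj₂ g xs ys = begin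
  doubleSum (cartesianProduct xs ys) (λ u v → g (proj₂ u) (proj₂ v))
    ≡⟨ doubleSum-cong (λ u v → sym (*-identityˡ _)) (cartesianProduct xs ys) ⟩
  doubleSum (cartesianProduct xs ys) (λ u v → 1 * g (proj₂ u) (proj₂ v))
    ≡⟨ doubleSum-cartesianProduct-* (λ _ _ → 1) g xs ys ⟩
  doubleSum xs (λ _ _ → 1) * doubleSum ys g
    ≡⟨ cong (_* doubleSum ys g) (trans (doubleSum-const 1 xs) (cong (length xs *_) (*-identityʳ _))) ⟩
  length xs * length xs * doubleSum ys g ∎
  where open ≡-Reasoning

-- Walks and distances

module _ {G : Graph} where
  open DecMembership (_≟_ G) using (_∈?_)

  private
    variable
      u v w : V G

  reach-sound : ∀ k → T (reach G k u v) → Walk G k u v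
  reach-sound {u} zero t = subst (Walk G 0 u) (toWitness t) here
  reach-sound (suc k) t
    with w , t′ ← satisfied (any⁻ _ (verts G) t)
    with uw , wv ← to T-∧ t′
    = step (to T-≡ uw) (reach-sound k wv)

  reach-complete : (∀ v → v ∈ verts G) → Walk G k u v → T (reach G k u v)
  reach-complete complete here = fromWitness refl
  reach-complete complete (step {w = w} uw p) =
    any⁺ _ (lose (complete w) (from T-∧ (from T-≡ uw , reach-complete complete p)))

  _▷_ : Walk G k u w → adj G w v ≡ true → Walk G (suc k) u v
  here     ▷ wv = step wv here
  step e p ▷ wv = step e (p ▷ wv)

  _++ʷ_ : Walk G m u w → Walk G n w v → Walk G (m + n) u v
  here     ++ʷ q = q
  step e p ++ʷ q = step e (p ++ʷ q)

  reverse : (∀ u v → adj G u v ≡ adj G v u) → Walk G k u v → Walk G k v u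
  reverse adj-sym here = here
  reverse adj-sym (step {u = u} {w = w} uw p) =
    reverse adj-sym p ▷ trans (adj-sym w u) uw

  vertices : Walk G k u v → List (V G)
  vertices {u = u} here       = u ∷ []
  vertices {u = u} (step _ p) = u ∷ vertices p

  length-vertices : (p : Walk G k u v) → length (vertices p) ≡ suc k
  length-vertices here       = refl
  length-vertices (step _ p) = cong suc (length-vertices p)

  Path : V G → V G → Set
  Path u v = ∃₂ λ k (p : Walk G k u v) → Unique (vertices p)

  suffixPath : (p : Walk G k w v) → Unique (vertices p) → u ∈ vertices p → Path u v
  suffixPath here       p-unique (here refl)  = _ , here , p-unique
  suffixPath (step e p) p-unique (here refl)  = _ , step e p , p-unique
  suffixPath (step _ p) (_ ∷ p-unique) (there u∈p) = suffixPath p p-unique u∈p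

  walk⇒path : Walk G k u v → Path u v
  walk⇒path here = _ , here , All.[] ∷ []
  walk⇒path {u = u} (step e p) with k , q , q-unique ← walk⇒path p with u ∈? vertices q
  ... | yes u∈q = suffixPath q q-unique u∈q
  ... | no  u∉q = suc k , step e q , ¬Any⇒All¬ _ u∉q ∷ q-unique

  walk⇒shortWalk : (∀ v → v ∈ verts G) → Walk G k u v → ∃ λ K → Walk G K u v × K < length (verts G)
  walk⇒shortWalk complete p with K , q , q-unique ← walk⇒path p =
    K , q , subst (_≤ length (verts G)) (length-vertices q) (unique-⊆⇒length≤ q-unique λ {x} _ → complete x)

  IsDistance : V G → V G → ℕ → Set
  IsDistance u v m = Walk G m u v × (∀ {j} → Walk G j u v → m ≤ j)

  isDistance-unique : IsDistance u v m → IsDistance u v n → m ≡ n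
  isDistance-unique (p , p-min) (q , q-min) = ≤-antisym (p-min q) (q-min p)

  -- dist only searches lengths below length (verts G), hence the detour through a path.
  dist-isDistance : (∀ v → v ∈ verts G) → Walk G k u v → IsDistance u v (dist G u v)
  dist-isDistance {u = u} {v} complete p with K , q , K< ← walk⇒shortWalk complete p =
    reach-sound _ (firstTrue-true reaches (length (verts G)) (reach-complete complete q) K<) ,
    λ r → ≮⇒≥ λ j<dist → firstTrue-least reaches (length (verts G)) j<dist (reach-complete complete r)
    where reaches = λ j → reach G j u v

  isDistance⇒dist : (∀ v → v ∈ verts G) → IsDistance u v m → dist G u v ≡ m
  isDistance⇒dist complete m-dist@(p , _) = isDistance-unique (dist-isDistance complete p) m-dist

module _ {G : Graph} (G-graph : IsGraph G) where
  open IsGraph G-graph renaming (symmetric to adj-symmetric)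

  connected⇒dist-isDistance : ∀ u v → IsDistance u v (dist G u v)
  connected⇒dist-isDistance u v = dist-isDistance complete (proj₂ (connected u v))

  dist-refl : ∀ u → dist G u u ≡ 0
  dist-refl u = isDistance⇒dist complete (here , λ _ → z≤n)

  dist-sym : ∀ u v → dist G u v ≡ dist G v u
  dist-sym u v with p , p-min ← connected⇒dist-isDistance u v =
    sym (isDistance⇒dist complete (reverse adj-symmetric p , p-min ∘ reverse adj-symmetric))

  dist-symmetricHollow : SymmetricHollow (dist G)
  dist-symmetricHollow = record { symmetric = dist-sym ; hollow = dist-refl }

  verts-nonempty : 0 < length (verts G)
  verts-nonempty = <⇒≤ twoVerts

  ecc≤diam : ∀ v → ecc G v ≤ diam G
  ecc≤diam v = f≤maxList (ecc G) (complete v)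

-- The cartesian product of graphs

module _ {G₁ G₂ : Graph} where
  private
    variable
      a b : V G₁
      x y : V G₂

  □-adjˡ : ∀ x → adj G₁ a b ≡ true → adj (G₁ □ G₂) (a , x) (b , x) ≡ true
  □-adjˡ x ab = to T-≡ (from T-∨ (inj₂ (from T-∧ (from T-≡ ab , fromWitness {a? = _≟_ G₂ x x} refl))))

  □-adjʳ : ∀ a → adj G₂ x y ≡ true → adj (G₁ □ G₂) (a , x) (a , y) ≡ true
  □-adjʳ a xy = to T-≡ (from T-∨ (inj₁ (from T-∧ (fromWitness {a? = _≟_ G₁ a a} refl , from T-≡ xy))))

  □-adj⁻ : adj (G₁ □ G₂) (a , x) (b , y) ≡ true →
           (a ≡ b × adj G₂ x y ≡ true) ⊎ (adj G₁ a b ≡ true × x ≡ y)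
  □-adj⁻ e with to T-∨ (from T-≡ e)
  ... | inj₁ t with a≡b , xy ← to T-∧ t = inj₁ (toWitness a≡b , to T-≡ xy)
  ... | inj₂ t with ab , x≡y ← to T-∧ t = inj₂ (to T-≡ ab , toWitness x≡y)

  □-walkˡ : ∀ x → Walk G₁ m a b → Walk (G₁ □ G₂) m (a , x) (b , x)
  □-walkˡ x here       = here
  □-walkˡ x (step e p) = step (□-adjˡ x e) (□-walkˡ x p)

  □-walkʳ : ∀ a → Walk G₂ n x y → Walk (G₁ □ G₂) n (a , x) (a , y)
  □-walkʳ a here       = here
  □-walkʳ a (step e p) = step (□-adjʳ a e) (□-walkʳ a p)

  □-walk⁻ : Walk (G₁ □ G₂) k (a , x) (b , y) →
            ∃₂ λ m n → Walk G₁ m a b × Walk G₂ n x y × m + n ≡ k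
  □-walk⁻ here = 0 , 0 , here , here , refl
  □-walk⁻ (step e p) with m , n , p₁ , p₂ , m+n≡k ← □-walk⁻ p with □-adj⁻ e
  ... | inj₁ (refl , xz) = m , suc n , p₁ , step xz p₂ , trans (+-suc m n) (cong suc m+n≡k)
  ... | inj₂ (ac , refl) = suc m , n , step ac p₁ , p₂ , cong suc m+n≡k

  module _ (G₁-graph : IsGraph G₁) (G₂-graph : IsGraph G₂) where
    open IsGraph

    □-complete : ∀ v → v ∈ verts (G₁ □ G₂)
    □-complete (a , x) = ∈-cartesianProduct⁺ (complete G₁-graph a) (complete G₂-graph x)

    dist-□ : ∀ a x b y → dist (G₁ □ G₂) (a , x) (b , y) ≡ dist G₁ a b + dist G₂ x y
    dist-□ a x b y
      with p , p-min ← connected⇒dist-isDistance G₁-graph a b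
         | q , q-min ← connected⇒dist-isDistance G₂-graph x y
      = isDistance⇒dist □-complete (□-walkˡ x p ++ʷ □-walkʳ b q , minimal)
      where
        minimal : ∀ {j} → Walk (G₁ □ G₂) j (a , x) (b , y) → dist G₁ a b + dist G₂ x y ≤ j
        minimal r with _ , _ , r₁ , r₂ , refl ← □-walk⁻ r = +-mono-≤ (p-min r₁) (q-min r₂)

module _ {G₁ G₂ : Graph} (G₁-graph : IsGraph G₁) (G₂-graph : IsGraph G₂) where

  ecc-□ : ∀ a x → ecc (G₁ □ G₂) (a , x) ≡ ecc G₁ a + ecc G₂ x
  ecc-□ a x = maxList-map-cartesianProduct-+ _ (λ b → dist G₁ b a) (λ y → dist G₂ y x) (verts G₁) (verts G₂)
    (λ b y → dist-□ G₁-graph G₂-graph b y a x) (verts-nonempty G₁-graph) (verts-nonempty G₂-graph)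

  diam-□ : diam (G₁ □ G₂) ≡ diam G₁ + diam G₂
  diam-□ = maxList-map-cartesianProduct-+ (ecc (G₁ □ G₂)) (ecc G₁) (ecc G₂) (verts G₁) (verts G₂)
    ecc-□ (verts-nonempty G₁-graph) (verts-nonempty G₂-graph)

  Peri-□ : Peri (G₁ □ G₂) ≡ cartesianProduct (Peri G₁) (Peri G₂)
  Peri-□ = trans (filterᵇ-cong peripheral-□ (cartesianProduct (verts G₁) (verts G₂)))
                 (filterᵇ-cartesianProduct _ _ (verts G₁) (verts G₂))
    where
      peripheral-□ : ∀ v → (ecc (G₁ □ G₂) v ≡ᵇ diam (G₁ □ G₂))
                         ≡ ((ecc G₁ (proj₁ v) ≡ᵇ diam G₁) ∧ (ecc G₂ (proj₂ v) ≡ᵇ diam G₂))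
      peripheral-□ (a , x) = trans (cong₂ _≡ᵇ_ (ecc-□ a x) diam-□)
                                   (≡ᵇ-+ (ecc≤diam G₁-graph a) (ecc≤diam G₂-graph x))

-- Definitionally, PW G = pairSum (Peri G) (dist G)
-- and PWW G = pairSum (Peri G) (λ u v → triangle (dist G u v)).
module _ {G₁ G₂ : Graph} (G₁-graph : IsGraph G₁) (G₂-graph : IsGraph G₂) where
  private
    P₁ = Peri G₁
    P₂ = Peri G₂
    k₁ = length P₁
    k₂ = length P₂
    L = cartesianProduct P₁ P₂
    d₁ = dist G₁
    d₂ = dist G₂
    d₁-sh = dist-symmetricHollow G₁-graph
    d₂-sh = dist-symmetricHollow G₂-graph
    triangle-sh : ∀ {A : Set} {f : A → A → ℕ} → SymmetricHollow f → SymmetricHollow (λ x y → triangle (f x y))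
    triangle-sh = ∘-symmetricHollow triangle refl

    d t₁ t₂ e : V G₁ × V G₂ → V G₁ × V G₂ → ℕ
    d  u v = d₁ (proj₁ u) (proj₁ v) + d₂ (proj₂ u) (proj₂ v)
    t₁ u v = triangle (d₁ (proj₁ u) (proj₁ v))
    t₂ u v = triangle (d₂ (proj₂ u) (proj₂ v))
    e  u v = d₁ (proj₁ u) (proj₁ v) * d₂ (proj₂ u) (proj₂ v)

  PWW-□ : PWW (G₁ □ G₂) ≡ pairSum L (λ u v → triangle (d u v))
  PWW-□ = trans (cong (λ ps → pairSum ps λ u v → triangle (dist (G₁ □ G₂) u v)) (Peri-□ G₁-graph G₂-graph))
                (sum-map-cong (λ _ → cong triangle (dist-□ G₁-graph G₂-graph _ _ _ _)) (pairs L))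

  twice-PWW-□ : 2 * PWW (G₁ □ G₂) ≡ k₂ * k₂ * (2 * PWW G₁) + k₁ * k₁ * (2 * PWW G₂) + 2 * PW G₁ * (2 * PW G₂)
  twice-PWW-□ = begin
    2 * PWW (G₁ □ G₂)
      ≡⟨ cong (2 *_) PWW-□ ⟩
    2 * pairSum L (λ u v → triangle (d u v))
      ≡⟨ sym (doubleSum≡2*pairSum (triangle-sh (×-symmetricHollow d₁-sh d₂-sh)) L) ⟩
    doubleSum L (λ u v → triangle (d u v))
      ≡⟨ doubleSum-cong (λ u v → triangle-+ (d₁ (proj₁ u) (proj₁ v)) (d₂ (proj₂ u) (proj₂ v))) L ⟩
    doubleSum L (λ u v → t₁ u v + t₂ u v + e u v)
      ≡⟨ trans (doubleSum-+ (λ u v → t₁ u v + t₂ u v) e L) (cong (_+ doubleSum L e) (doubleSum-+ t₁ t₂ L)) ⟩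
    doubleSum L t₁ + doubleSum L t₂ + doubleSum L e
      ≡⟨ cong₂ _+_ (cong₂ _+_ (doubleSum-cartesianProduct-proj₁ (λ a b → triangle (d₁ a b)) P₁ P₂)
                              (doubleSum-cartesianProduct-proj₂ (λ x y → triangle (d₂ x y)) P₁ P₂))
                   (doubleSum-cartesianProduct-* d₁ d₂ P₁ P₂) ⟩
    k₂ * k₂ * doubleSum P₁ (λ a b → triangle (d₁ a b)) + k₁ * k₁ * doubleSum P₂ (λ x y → triangle (d₂ x y))
      + doubleSum P₁ d₁ * doubleSum P₂ d₂
      ≡⟨ cong₂ _+_ (cong₂ _+_ (cong (k₂ * k₂ *_) (doubleSum≡2*pairSum (triangle-sh d₁-sh) P₁))
                              (cong (k₁ * k₁ *_) (doubleSum≡2*pairSum (triangle-sh d₂-sh) P₂)))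
                   (cong₂ _*_ (doubleSum≡2*pairSum d₁-sh P₁) (doubleSum≡2*pairSum d₂-sh P₂)) ⟩
    k₂ * k₂ * (2 * PWW G₁) + k₁ * k₁ * (2 * PWW G₂) + 2 * PW G₁ * (2 * PW G₂) ∎
    where open ≡-Reasoning

mainTheorem9 : (G₁ G₂ : Graph) → IsGraph G₁ → IsGraph G₂ →
    PWW (G₁ □ G₂) ≡ length (Peri G₂) * length (Peri G₂) * PWW G₁
                    + length (Peri G₁) * length (Peri G₁) * PWW G₂
                    + 2 * PW G₁ * PW G₂
mainTheorem9 G₁ G₂ G₁-graph G₂-graph =
  *-cancelˡ-≡ _ _ 2 (trans (twice-PWW-□ G₁-graph G₂-graph) (factor k₂ (PWW G₁) k₁ (PWW G₂) (PW G₁) (PW G₂)))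
  where
    k₁ = length (Peri G₁)
    k₂ = length (Peri G₂)
    factor : ∀ k₂ w₁ k₁ w₂ p₁ p₂ →
             k₂ * k₂ * (2 * w₁) + k₁ * k₁ * (2 * w₂) + 2 * p₁ * (2 * p₂)
             ≡ 2 * (k₂ * k₂ * w₁ + k₁ * k₁ * w₂ + 2 * p₁ * p₂)
    factor = solve-∀
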